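{- Let $b,x_1$ be positive integers with $(b,x_1)\neq(1,1)$. Then the game $L(b;x_1,0;1,1)$ has diagonal periodicity.
   Context: The Lengyel transfer game $L(b;x_1,y_1;x_2,y_2)$ is the impartial normal-play game on positions $(x,y)\in\mathbb{N}^2$ in which a move consists of adding one of $(0,-b)$, $(-x_1,y_1)$, $(-x_2,y_2)$, provided the result lies in $\mathbb{N}^2$; $\mathcal{SG}(x,y)$ is the Sprague–Grundy value. Let $\mathcal{SG}^*(x,y)=\mathcal{SG}(x,y)$ if $\mathcal{SG}(x,y)\in\{0,1,2\}$ and $\mathcal{SG}^*(x,y)=2$ if $\mathcal{SG}(x,y)=3$. The game has diagonal periodicity if for all $(x,y)\in\mathbb{N}^2$ with $y\ge y_1+y_2$, $\mathcal{SG}^*(x,y)=\mathcal{SG}^*(x+x_1+x_2,\,y-y_1-y_2)$. -}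

module Defs where

open import Data.Nat using (ℕ; zero; suc; _+_; _∸_; _≤_; _<_; _≤?_; _≟_)
open import Data.Nat.Properties using (∸-monoʳ-<; n<1+n)
open import Data.Nat.Induction using (<-rec)
open import Data.List using (List; []; _∷_; _++_; length)
open import Data.List.Membership.DecPropositional _≟_ using (_∈?_)
open import Relation.Nullary using (yes; no)

-- mex of a finite list of naturals: the least natural not occurring in it.
-- Searching 0,1,…,length l suffices (pigeonhole), so the fuel is exact.
mexGo : ℕ → ℕ → List ℕ → ℕ
mexGo zero    k l = k
mexGo (suc f) k l with k ∈? l
... | yes _ = mexGo f (suc k) l
... | no  _ = k

mex : List ℕ → ℕ
mex l = mexGo (length l) 0 l

private
  moveXY : (dx dy : ℕ) (x : ℕ) → ({x' : ℕ} → x' < x → ℕ → ℕ) → ℕ → List ℕ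
  moveXY dx dy x rec y with 1 ≤? dx | dx ≤? x
  ... | yes p | yes q = rec {x ∸ dx} (∸-monoʳ-< p q) (y + dy) ∷ []
  ... | _     | _     = []

  moveB : (b : ℕ) (y : ℕ) → ({y' : ℕ} → y' < y → ℕ) → List ℕ
  moveB b y r with 1 ≤? b | b ≤? y
  ... | yes p | yes q = r {y ∸ b} (∸-monoʳ-< p q) ∷ []
  ... | _     | _     = []

-- Sprague–Grundy function SG(x , y) of the Lengyel transfer game
-- L(b; x₁,y₁; x₂,y₂): moves (0,-b), (-x₁,y₁), (-x₂,y₂), staying in ℕ².
-- Moves with b = 0 resp. x₁ = 0 resp. x₂ = 0 would make the game
-- non-terminating; such moves are simply omitted (irrelevant whenever
-- b, x₁, x₂ ≥ 1, which is the case for the theorem).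
SG : (b x₁ y₁ x₂ y₂ : ℕ) → ℕ → ℕ → ℕ
SG b x₁ y₁ x₂ y₂ = <-rec (λ _ → ℕ → ℕ) row
  where
  row : (x : ℕ) → ({x' : ℕ} → x' < x → ℕ → ℕ) → ℕ → ℕ
  row x rec = <-rec (λ _ → ℕ) cell
    where
    cell : (y : ℕ) → ({y' : ℕ} → y' < y → ℕ) → ℕ
    cell y r = mex (moveB b y r ++ moveXY x₁ y₁ x rec y ++ moveXY x₂ y₂ x rec y)

SG* : ℕ → ℕ
SG* 3 = 2
SG* n = n

DiagonalPeriodic : (b x₁ y₁ x₂ y₂ : ℕ) → Set
DiagonalPeriodic b x₁ y₁ x₂ y₂ =
  (x y : ℕ) → y₁ + y₂ ≤ y →
  SG* (SG b x₁ y₁ x₂ y₂ x y) ≡ SG* (SG b x₁ y₁ x₂ y₂ (x + x₁ + x₂) (y ∸ (y₁ + y₂)))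
  where open import Relation.Binary.PropositionalEquality using (_≡_)

module Submission where

-- Write x = r + m (x₁ + 1) with r ≤ x₁ and put q = m + y, which the diagonal shift
-- (x, y) ↦ (x + x₁ + 1, y − 1) leaves unchanged; it suffices to show that SG* depends
-- only on r and q. Let h n be the parity of ⌊n / b⌋. On an inner column r < x₁, SG* is
-- h (q + r (b + 1)) read as 0 or 1; on the last column r = x₁ it is the mex, capped at 2,
-- of the values of the two moves that are always available there, to the columns 0 and
-- x₁ − 1. A position has at most three options, so its SG* value is the capped mex of
-- the SG* values of its options, and the formula is checked against that recursion. On
-- an inner column every option has value 1 − h (q + r (b + 1)) or 2, and some option has
-- value 0 when h (q + r (b + 1)) = 1. The delicate case is column 0 with x₁ = 1 and
-- y < b: there the block of b ≥ 2 consecutive integers with the same ⌊n / b⌋ gives q a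
-- neighbour with the same parity, and this is where (b, x₁) ≠ (1, 1) is used.

open import Defs
open import Data.Nat using (ℕ; _<_)
open import Data.Product using (_×_)
open import Relation.Binary.PropositionalEquality using (_≡_)
open import Relation.Nullary using (¬_)
open import Data.Bool.Base using (Bool; true; false; not)
open import Data.List.Base using (List; []; _∷_; _++_; length; map)
open import Data.List.Membership.Propositional using (_∈_; _∉_)
open import Data.List.Relation.Unary.All as All using (All; []; _∷_)
open import Data.List.Relation.Unary.Any using (here; there)
open import Data.Nat.Base
open import Data.Nat.Properties
open import Data.Nat.DivMod
open import Data.List.Membership.DecPropositional _≟_ using (_∈?_)
open import Data.Nat.Induction using (<-rec; <-recBuilder; <′-wellFounded; <′-wellFounded′)
open import Data.Product.Base using (Σ; _,_)
open import Data.Sum.Base using (_⊎_; inj₁; inj₂)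
open import Function.Base using (_∘_)
open import Induction.WellFounded using (module Some; module Subrelation)
open import Relation.Binary.PropositionalEquality
open import Relation.Nullary using (Dec; yes; no; contradiction)

mex* : List ℕ → ℕ
mex* l with 0 ∈? l | 1 ∈? l
... | no _  | _     = 0
... | yes _ | no _  = 1
... | yes _ | yes _ = 2

mexGo-∉ : ∀ f {k l} → k ∉ l → mexGo f k l ≡ k
mexGo-∉ zero    _   = refl
mexGo-∉ (suc f) {k} {l} k∉l with k ∈? l
... | yes k∈l = contradiction k∈l k∉l
... | no  _   = refl

mexGo-∈ : ∀ f {k l} → k ∈ l → mexGo (suc f) k l ≡ mexGo f (suc k) l
mexGo-∈ f {k} {l} k∈l with k ∈? l
... | yes _   = refl
... | no  k∉l = contradiction k∈l k∉l

SG*-mexGo-1-2 : ∀ l → SG* (mexGo 1 2 l) ≡ 2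
SG*-mexGo-1-2 l with 2 ∈? l
... | yes _ = refl
... | no  _ = refl

∈⇒length>0 : ∀ {n} {l : List ℕ} → n ∈ l → 0 < length l
∈⇒length>0 (here _)  = z<s
∈⇒length>0 (there _) = z<s

0∈∧1∈⇒length>1 : ∀ {l} → 0 ∈ l → 1 ∈ l → 1 < length l
0∈∧1∈⇒length>1 (here refl) (here ())
0∈∧1∈⇒length>1 (here refl) (there 1∈) = s≤s (∈⇒length>0 1∈)
0∈∧1∈⇒length>1 (there 0∈) _ = s≤s (∈⇒length>0 0∈)

SG*<2⇒SG*≡id : ∀ v → SG* v < 2 → SG* v ≡ v
SG*<2⇒SG*≡id 0 _ = refl
SG*<2⇒SG*≡id 1 _ = refl
SG*<2⇒SG*≡id 2 (s≤s (s≤s ()))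
SG*<2⇒SG*≡id 3 (s≤s (s≤s ()))
SG*<2⇒SG*≡id (suc (suc (suc (suc v)))) (s≤s (s≤s ()))

∈-map⁺ : ∀ (f : ℕ → ℕ) {n l} → n ∈ l → f n ∈ map f l
∈-map⁺ f (here refl) = here refl
∈-map⁺ f (there n∈)  = there (∈-map⁺ f n∈)

∈-map-SG*⁻ : ∀ {n} l → n < 2 → n ∈ map SG* l → n ∈ l
∈-map-SG*⁻ (v ∷ l) n<2 (here n≡SG*v) = here (trans n≡SG*v (SG*<2⇒SG*≡id v (subst (_< 2) n≡SG*v n<2)))
∈-map-SG*⁻ (v ∷ l) n<2 (there n∈)    = there (∈-map-SG*⁻ l n<2 n∈)

-- mex l ≤ length l ≤ 3, so SG* (mex l) only depends on whether 0 and 1 occur in l.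
SG*-mex : ∀ l → length l ≤ 3 → SG* (mex l) ≡ mex* (map SG* l)
SG*-mex l len≤3 with 0 ∈? map SG* l | 1 ∈? map SG* l
... | no 0∉ | _ = cong SG* (mexGo-∉ (length l) (λ 0∈ → 0∉ (∈-map⁺ SG* 0∈)))
... | yes 0∈ | no 1∉ = cong SG* (mexGo≡1 (length l) (∈⇒length>0 (∈-map-SG*⁻ l (s≤s z≤n) 0∈)))
  where
  mexGo≡1 : ∀ f → 0 < f → mexGo f 0 l ≡ 1
  mexGo≡1 (suc f) _ = trans (mexGo-∈ f (∈-map-SG*⁻ l (s≤s z≤n) 0∈)) (mexGo-∉ f (λ 1∈ → 1∉ (∈-map⁺ SG* 1∈)))
... | yes 0∈ | yes 1∈ = SG*-mexGo≡2 (length l) (0∈∧1∈⇒length>1 0∈l 1∈l) len≤3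
  where
  0∈l : 0 ∈ l
  0∈l = ∈-map-SG*⁻ l (s≤s z≤n) 0∈
  1∈l : 1 ∈ l
  1∈l = ∈-map-SG*⁻ l (s≤s (s≤s z≤n)) 1∈
  SG*-mexGo≡2 : ∀ f → 1 < f → f ≤ 3 → SG* (mexGo f 0 l) ≡ 2
  SG*-mexGo≡2 1 (s≤s ()) _
  SG*-mexGo≡2 2 _ _ rewrite mexGo-∈ 1 0∈l | mexGo-∈ 0 1∈l = refl
  SG*-mexGo≡2 3 _ _ rewrite mexGo-∈ 2 0∈l | mexGo-∈ 1 1∈l = SG*-mexGo-1-2 l
  SG*-mexGo≡2 (suc (suc (suc (suc _)))) _ (s≤s (s≤s (s≤s ())))

toℕ : Bool → ℕ
toℕ false = 0
toℕ true  = 1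

mex*-∉0 : ∀ {l} → 0 ∉ l → mex* l ≡ 0
mex*-∉0 {l} 0∉l with 0 ∈? l
... | yes 0∈l = contradiction 0∈l 0∉l
... | no _    = refl

mex*-∈0∉1 : ∀ {l} → 0 ∈ l → 1 ∉ l → mex* l ≡ 1
mex*-∈0∉1 {l} 0∈l 1∉l with 0 ∈? l | 1 ∈? l
... | no 0∉l | _       = contradiction 0∈l 0∉l
... | yes _  | yes 1∈l = contradiction 1∈l 1∉l
... | yes _  | no _    = refl

mex*-∈0∈1 : ∀ {l} → 0 ∈ l → 1 ∈ l → mex* l ≡ 2
mex*-∈0∈1 {l} 0∈l 1∈l with 0 ∈? l | 1 ∈? l
... | no 0∉l | _      = contradiction 0∈l 0∉l
... | yes _  | no 1∉l = contradiction 1∈l 1∉l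
... | yes _  | yes _  = refl

All⇒∉ : ∀ {Q : ℕ → Set} {n l} → All Q l → ¬ Q n → n ∉ l
All⇒∉ all ¬Qn n∈l = ¬Qn (All.lookup all n∈l)

mex*-bit : ∀ β {l} → All (λ v → v ≡ toℕ (not β) ⊎ v ≡ 2) l → (β ≡ true → 0 ∈ l) → mex* l ≡ toℕ β
mex*-bit false all _  = mex*-∉0 (All⇒∉ all λ { (inj₁ ()) ; (inj₂ ()) })
mex*-bit true  all 0∈ = mex*-∈0∉1 (0∈ refl) (All⇒∉ all λ { (inj₁ ()) ; (inj₂ ()) })

mex*-pair : Bool → Bool → ℕ
mex*-pair c d = mex* (toℕ c ∷ toℕ d ∷ [])

mex*-pair-left : ∀ c d → mex*-pair c d ≡ toℕ (not c) ⊎ mex*-pair c d ≡ 2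
mex*-pair-left false false = inj₁ refl
mex*-pair-left false true  = inj₂ refl
mex*-pair-left true  false = inj₂ refl
mex*-pair-left true  true  = inj₁ refl

mex*-pair-right : ∀ c d → mex*-pair c d ≡ toℕ (not d) ⊎ mex*-pair c d ≡ 2
mex*-pair-right false false = inj₁ refl
mex*-pair-right false true  = inj₂ refl
mex*-pair-right true  false = inj₂ refl
mex*-pair-right true  true  = inj₁ refl

mex*≡mex*-pair : ∀ c d {l} → All (λ v → v ≡ toℕ c ⊎ v ≡ toℕ d ⊎ v ≡ mex*-pair (not c) (not d)) l →
  toℕ c ∈ l → toℕ d ∈ l → mex* l ≡ mex*-pair c d
mex*≡mex*-pair false false all 0∈ _ = mex*-∈0∉1 0∈ (All⇒∉ all λ { (inj₁ ()) ; (inj₂ (inj₁ ())) ; (inj₂ (inj₂ ())) })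
mex*≡mex*-pair false true  _   0∈ 1∈ = mex*-∈0∈1 0∈ 1∈
mex*≡mex*-pair true  false _   1∈ 0∈ = mex*-∈0∈1 0∈ 1∈
mex*≡mex*-pair true  true  all _ _ = mex*-∉0 (All⇒∉ all λ { (inj₁ ()) ; (inj₂ (inj₁ ())) ; (inj₂ (inj₂ ())) })

moveIf : {P : Set} → Dec P → (P → ℕ) → List ℕ
moveIf (yes p) v = v p ∷ []
moveIf (no _)  _ = []

moveIf-cong : {P : Set} (d : Dec P) {u v : P → ℕ} → (∀ p → u p ≡ v p) → moveIf d u ≡ moveIf d v
moveIf-cong (yes p) u≗v = cong (_∷ []) (u≗v p)
moveIf-cong (no _)  _   = refl

length-moveIf : {P : Set} (d : Dec P) (v : P → ℕ) → length (moveIf d v) ≤ 1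
length-moveIf (yes _) _ = ≤-refl
length-moveIf (no _)  _ = z≤n

map-moveIf : {P : Set} (f : ℕ → ℕ) (d : Dec P) (v : P → ℕ) → map f (moveIf d v) ≡ moveIf d (f ∘ v)
map-moveIf f (yes _) v = refl
map-moveIf f (no _)  v = refl

All-moveIf : {P : Set} {Q : ℕ → Set} (d : Dec P) {v : P → ℕ} → (∀ p → Q (v p)) → All Q (moveIf d v)
All-moveIf (yes p) Qv = Qv p ∷ []
All-moveIf (no _)  _  = []

∈-moveIf : {P : Set} (d : Dec P) {v : ℕ} → P → v ∈ moveIf d (λ _ → v)
∈-moveIf (yes _) _ = here refl
∈-moveIf (no ¬p) p = contradiction p ¬p

length-moveIf-++ : {P : Set} (d : Dec P) (v : P → ℕ) (l : List ℕ) → length (moveIf d v ++ l) ≤ suc (length l)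
length-moveIf-++ (yes _) _ l = ≤-refl
length-moveIf-++ (no _)  _ l = n≤1+n (length l)

map-moveIf-++ : {P : Set} (f : ℕ → ℕ) (d : Dec P) (v : P → ℕ) (l : List ℕ) →
  map f (moveIf d v ++ l) ≡ moveIf d (f ∘ v) ++ map f l
map-moveIf-++ f (yes _) v l = refl
map-moveIf-++ f (no _)  v l = refl

All-moveIf-++ : {P : Set} {Q : ℕ → Set} (d : Dec P) {v : P → ℕ} {l : List ℕ} →
  (∀ p → Q (v p)) → All Q l → All Q (moveIf d v ++ l)
All-moveIf-++ (yes p) Qv Ql = Qv p ∷ Ql
All-moveIf-++ (no _)  _  Ql = Ql

∈-moveIf-++ˡ : {P : Set} (d : Dec P) {v : ℕ} (l : List ℕ) → P → v ∈ moveIf d (λ _ → v) ++ l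
∈-moveIf-++ˡ (yes _) l _ = here refl
∈-moveIf-++ˡ (no ¬p) l p = contradiction p ¬p

∈-moveIf-++ʳ : {P : Set} (d : Dec P) (v : P → ℕ) {n : ℕ} {l : List ℕ} → n ∈ l → n ∈ moveIf d v ++ l
∈-moveIf-++ʳ (yes _) v n∈l = there n∈l
∈-moveIf-++ʳ (no _)  v n∈l = n∈l

-- The moves (0, −b), (−x₁, 0), (−1, +1) of L(b; x₁, 0; 1, 1), called A, B, C below.
options : (b x₁ : ℕ) → (ℕ → ℕ → ℕ) → ℕ → ℕ → List ℕ
options b x₁ g x y =
  moveIf (b ≤? y) (λ _ → g x (y ∸ b)) ++ moveIf (x₁ ≤? x) (λ _ → g (x ∸ x₁) y) ++ moveIf (1 ≤? x) (λ _ → g (x ∸ 1) (suc y))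

module _ (b x₁ : ℕ) (g : ℕ → ℕ → ℕ) (x y : ℕ) where

  private
    A B C : List ℕ
    A = moveIf (b ≤? y) (λ _ → g x (y ∸ b))
    B = moveIf (x₁ ≤? x) (λ _ → g (x ∸ x₁) y)
    C = moveIf (1 ≤? x) (λ _ → g (x ∸ 1) (suc y))

  length-options : length (options b x₁ g x y) ≤ 3
  length-options = begin
    length (A ++ B ++ C)     ≤⟨ length-moveIf-++ (b ≤? y) _ (B ++ C) ⟩
    suc (length (B ++ C))    ≤⟨ s≤s (length-moveIf-++ (x₁ ≤? x) _ C) ⟩
    2 + length C             ≤⟨ s≤s (s≤s (length-moveIf (1 ≤? x) _)) ⟩
    3                        ∎
    where open ≤-Reasoning

  map-options : (f : ℕ → ℕ) → map f (options b x₁ g x y) ≡ options b x₁ (λ x y → f (g x y)) x y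
  map-options f = begin
    map f (A ++ B ++ C)                   ≡⟨ map-moveIf-++ f (b ≤? y) _ (B ++ C) ⟩
    fA ++ map f (B ++ C)                  ≡⟨ cong (fA ++_) (map-moveIf-++ f (x₁ ≤? x) _ C) ⟩
    fA ++ fB ++ map f C                   ≡⟨ cong (λ l → fA ++ fB ++ l) (map-moveIf f (1 ≤? x) _) ⟩
    options b x₁ (λ x y → f (g x y)) x y  ∎
    where
    open ≡-Reasoning
    fA fB : List ℕ
    fA = moveIf (b ≤? y) (λ _ → f (g x (y ∸ b)))
    fB = moveIf (x₁ ≤? x) (λ _ → f (g (x ∸ x₁) y))

  options-cong : (h : ℕ → ℕ → ℕ) →
    (b ≤ y → g x (y ∸ b) ≡ h x (y ∸ b)) → (x₁ ≤ x → g (x ∸ x₁) y ≡ h (x ∸ x₁) y) →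
    (1 ≤ x → g (x ∸ 1) (suc y) ≡ h (x ∸ 1) (suc y)) → options b x₁ g x y ≡ options b x₁ h x y
  options-cong h eqA eqB eqC =
    cong₂ _++_ (moveIf-cong (b ≤? y) eqA) (cong₂ _++_ (moveIf-cong (x₁ ≤? x) eqB) (moveIf-cong (1 ≤? x) eqC))

  All-options : {Q : ℕ → Set} → (b ≤ y → Q (g x (y ∸ b))) → (x₁ ≤ x → Q (g (x ∸ x₁) y)) →
    (1 ≤ x → Q (g (x ∸ 1) (suc y))) → All Q (options b x₁ g x y)
  All-options QA QB QC = All-moveIf-++ (b ≤? y) QA (All-moveIf-++ (x₁ ≤? x) QB (All-moveIf (1 ≤? x) QC))

  ∈-options-A : b ≤ y → g x (y ∸ b) ∈ options b x₁ g x y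
  ∈-options-A = ∈-moveIf-++ˡ (b ≤? y) _

  ∈-options-B : x₁ ≤ x → g (x ∸ x₁) y ∈ options b x₁ g x y
  ∈-options-B x₁≤x = ∈-moveIf-++ʳ (b ≤? y) _ (∈-moveIf-++ˡ (x₁ ≤? x) C x₁≤x)

  ∈-options-C : 1 ≤ x → g (x ∸ 1) (suc y) ∈ options b x₁ g x y
  ∈-options-C 1≤x = ∈-moveIf-++ʳ (b ≤? y) _ (∈-moveIf-++ʳ (x₁ ≤? x) _ (∈-moveIf (1 ≤? x) 1≤x))

-- The recursion equation of SG

<′-wellFounded′≡<′-wellFounded : ∀ n {k} (k<′n : k <′ n) → <′-wellFounded′ n k<′n ≡ <′-wellFounded k
<′-wellFounded′≡<′-wellFounded (suc n) <′-base         = refl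
<′-wellFounded′≡<′-wellFounded (suc n) (<′-step k<′n) = <′-wellFounded′≡<′-wellFounded n k<′n

RowRec : ℕ → Set
RowRec x = {x′ : ℕ} → x′ < x → ℕ → ℕ

Row : Set
Row = (x : ℕ) → RowRec x → ℕ → ℕ

<-recBuilder-at : (f : Row) → ∀ {x x′} (x′<x : x′ < x) z →
  <-recBuilder _ f x x′<x z ≡ f x′ (<-recBuilder _ f x′) z
<-recBuilder-at f {x} {x′} x′<x z =
  cong (λ a → f x′ (Some.wfRecBuilder _ f x′ (Subrelation.accessible <⇒<′ a)) z)
       (<′-wellFounded′≡<′-wellFounded x (<⇒<′ x′<x))

-- `SG` recurses on x through a function local to its definition in Defs, which cannot
-- be named here. `row-of b′ x₁ p` is that function for b = b′ + 1, found by unification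
-- while checking `SG-from-origin`: from the origin, two moves forced by its (never
-- satisfiable) hypotheses expose it as the argument of a stuck well-founded recursor.
-- The lemma serves no other purpose; `p` is the proof of 1 ≤ x₁ occurring in the solution.
mutual
  row-of : (b′ x₁ : ℕ) → 1 ≤ x₁ → Row
  row-of = _

  SG-from-origin : ∀ b′ x₁ → 1 ≤ x₁ → x₁ ≤ 0 →
    Σ (1 ≤ x₁) λ p → Σ (x₁ ≤ 0) λ q → Σ (1 ≤ 0 ∸ x₁) λ r →
    SG (suc b′) x₁ 0 1 1 0 0 ≡
    mex (mex (Some.wfRecBuilder _ (row-of b′ x₁ p) (0 ∸ x₁)
                (Subrelation.accessible <⇒<′ (<′-wellFounded′ 0 (<⇒<′ (∸-monoʳ-< p q))))
                (∸-monoʳ-< z<s r) (0 + 0 + 1)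
              ∷ [])
         ∷ [])
  SG-from-origin b′ x₁ 1≤x₁ x₁≤0 with 1 ≤? x₁ | x₁ ≤? 0
  ... | yes p | yes q with x₁ ≤? 0 ∸ x₁ | 1 ≤? 0 ∸ x₁
  ...   | no _ | yes r = p , q , r , refl
  ...   | _    | _     = contradiction 1≤x₁ (<⇒≱ (s≤s x₁≤0))
  SG-from-origin b′ x₁ 1≤x₁ x₁≤0 | _ | _ = contradiction 1≤x₁ (<⇒≱ (s≤s x₁≤0))

module Unfolding (b′ x₁′ : ℕ) where

  G : ℕ → ℕ → ℕ
  G = SG (suc b′) (suc x₁′) 0 1 1

  row : Row
  row = row-of b′ (suc x₁′) z<s

  row-unfold : ∀ x (rec : RowRec x) (f : ℕ → ℕ → ℕ) → (∀ {x′} (x′<x : x′ < x) z → rec x′<x z ≡ f x′ z) →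
    ∀ y → row x rec y ≡ mex (moveIf (suc b′ ≤? y) (λ _ → row x rec (y ∸ suc b′))
                             ++ moveIf (suc x₁′ ≤? x) (λ _ → f (x ∸ suc x₁′) y)
                             ++ moveIf (1 ≤? x) (λ _ → f (x ∸ 1) (suc y)))
  row-unfold x rec f rec≗f y = trans (by-cases y)
    (cong (λ BC → mex (moveIf (suc b′ ≤? y) (λ _ → row x rec (y ∸ suc b′)) ++ BC)) (cong₂ _++_
      (moveIf-cong (suc x₁′ ≤? x) λ x₁≤x →
        trans (rec≗f (∸-monoʳ-< z<s x₁≤x) (y + 0)) (cong (f (x ∸ suc x₁′)) (+-identityʳ y)))
      (moveIf-cong (1 ≤? x) λ 1≤x →
        trans (rec≗f (∸-monoʳ-< z<s 1≤x) (y + 1)) (cong (f (x ∸ 1)) (+-comm y 1)))))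
    where
    by-cases : ∀ y → row x rec y ≡ mex (moveIf (suc b′ ≤? y) (λ _ → row x rec (y ∸ suc b′))
                                        ++ moveIf (suc x₁′ ≤? x) (λ x₁≤x → rec (∸-monoʳ-< z<s x₁≤x) (y + 0))
                                        ++ moveIf (1 ≤? x) (λ 1≤x → rec (∸-monoʳ-< z<s 1≤x) (y + 1)))
    by-cases y with suc b′ ≤? y | suc x₁′ ≤? x | 1 ≤? x
    ... | no _    | no _  | no _  = refl
    ... | no _    | no _  | yes _ = refl
    ... | no _    | yes _ | no _  = refl
    ... | no _    | yes _ | yes _ = refl
    ... | yes b≤y | B     | C rewrite <′-wellFounded′≡<′-wellFounded y (<⇒<′ (∸-monoʳ-< {y} {suc b′} {0} z<s b≤y))
      with B | C
    ...   | no _  | no _  = refl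
    ...   | no _  | yes _ = refl
    ...   | yes _ | no _  = refl
    ...   | yes _ | yes _ = refl

  SG′ : ℕ → ℕ → ℕ
  SG′ x = row x (<-recBuilder _ row x)

  SG′-unfold : ∀ x y → SG′ x y ≡ mex (options (suc b′) (suc x₁′) SG′ x y)
  SG′-unfold x y = row-unfold x (<-recBuilder _ row x) SG′ (<-recBuilder-at row) y

  G≡SG′ : ∀ x y → G x y ≡ SG′ x y
  G≡SG′ x y = refl

  G-unfold : ∀ x y → G x y ≡ mex (options (suc b′) (suc x₁′) G x y)
  G-unfold x y = begin
    G x y                                   ≡⟨ G≡SG′ x y ⟩
    SG′ x y                                 ≡⟨ SG′-unfold x y ⟩
    mex (options (suc b′) (suc x₁′) SG′ x y) ≡⟨ cong mex (options-cong (suc b′) (suc x₁′) SG′ x y G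
                                                 (λ _ → sym (G≡SG′ x (y ∸ suc b′)))
                                                 (λ _ → sym (G≡SG′ (x ∸ suc x₁′) y))
                                                 (λ _ → sym (G≡SG′ (x ∸ 1) (suc y)))) ⟩
    mex (options (suc b′) (suc x₁′) G x y)   ∎
    where open ≡-Reasoning

  SG*-unique : (g : ℕ → ℕ → ℕ) → (∀ x y → mex* (options (suc b′) (suc x₁′) g x y) ≡ g x y) →
    ∀ x y → SG* (G x y) ≡ g x y
  SG*-unique g g-solves = <-rec _ λ x IHx → <-rec _ (step x IHx)
    where
    step : ∀ x → (∀ {x′} → x′ < x → ∀ y → SG* (G x′ y) ≡ g x′ y) →
           ∀ y → (∀ {y′} → y′ < y → SG* (G x y′) ≡ g x y′) → SG* (G x y) ≡ g x y
    step x IHx y IHy = begin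
      SG* (G x y)                                          ≡⟨ cong SG* (G-unfold x y) ⟩
      SG* (mex (options (suc b′) (suc x₁′) G x y))         ≡⟨ SG*-mex _ (length-options (suc b′) (suc x₁′) G x y) ⟩
      mex* (map SG* (options (suc b′) (suc x₁′) G x y))    ≡⟨ cong mex* (map-options (suc b′) (suc x₁′) G x y SG*) ⟩
      mex* (options (suc b′) (suc x₁′) (λ x y → SG* (G x y)) x y)
        ≡⟨ cong mex* (options-cong (suc b′) (suc x₁′) (λ x y → SG* (G x y)) x y g
                       (λ b≤y → IHy (∸-monoʳ-< z<s b≤y))
                       (λ x₁≤x → IHx (∸-monoʳ-< z<s x₁≤x) y)
                       (λ 1≤x → IHx (∸-monoʳ-< z<s 1≤x) (suc y))) ⟩
      mex* (options (suc b′) (suc x₁′) g x y)              ≡⟨ g-solves x y ⟩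
      g x y                                                ∎
      where open ≡-Reasoning

-- The closed form

[s+t*n]/n≡t : ∀ {s} t n .⦃ _ : NonZero n ⦄ → s < n → (s + t * n) / n ≡ t
[s+t*n]/n≡t {s} t n s<n = begin
  (s + t * n) / n    ≡⟨ +-distrib-/ s (t * n) (subst (_< n) (sym s%n+tn%n≡s) s<n) ⟩
  s / n + t * n / n  ≡⟨ cong₂ _+_ (m<n⇒m/n≡0 s<n) (m*n/n≡m t n) ⟩
  t                  ∎
  where
  open ≡-Reasoning
  s%n+tn%n≡s : s % n + t * n % n ≡ s
  s%n+tn%n≡s = trans (cong₂ _+_ (m<n⇒m%n≡m s<n) (m*n%n≡0 t n)) (+-identityʳ s)

[m+n]/n≡1+m/n : ∀ m n .⦃ _ : NonZero n ⦄ → (m + n) / n ≡ suc (m / n)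
[m+n]/n≡1+m/n m n = trans (m/n≡1+[m∸n]/n (m≤n+m n m)) (cong (λ k → suc (k / n)) (m+n∸n≡m m n))

not-involutive : ∀ c → not (not c) ≡ c
not-involutive false = refl
not-involutive true  = refl

odd : ℕ → Bool
odd zero    = false
odd (suc n) = not (odd n)

module ClosedForm (b x₁ : ℕ) ⦃ _ : NonZero b ⦄ ⦃ _ : NonZero x₁ ⦄ where

  oddBlock : ℕ → Bool
  oddBlock n = odd (n / b)

  oddBlock-+b : ∀ n → oddBlock (n + b) ≡ not (oddBlock n)
  oddBlock-+b n = cong odd ([m+n]/n≡1+m/n n b)

  oddBlock-< : ∀ {n} → n < b → oddBlock n ≡ false
  oddBlock-< n<b = cong odd (m<n⇒m/n≡0 n<b)

  oddBlock-digit : ∀ {s} t → s < b → oddBlock (s + t * b) ≡ odd t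
  oddBlock-digit t s<b = cong odd ([s+t*n]/n≡t t b s<b)

  oddBlock-neighbour : 1 < b → ∀ n → oddBlock (suc n) ≡ true → oddBlock n ≡ true ⊎ oddBlock (suc (suc n)) ≡ true
  oddBlock-neighbour 1<b n odd-sn = split (suc n % b) (m%n<n (suc n) b) (m≡m%n+[m/n]*n (suc n) b)
    where
    t : ℕ
    t = suc n / b
    split : ∀ s → s < b → suc n ≡ s + t * b → oddBlock n ≡ true ⊎ oddBlock (suc (suc n)) ≡ true
    split zero    _   sn≡ = inj₂ (begin
      oddBlock (2 + n)      ≡⟨ cong (oddBlock ∘ suc) sn≡ ⟩
      oddBlock (1 + t * b)  ≡⟨ oddBlock-digit t 1<b ⟩
      odd t                 ≡⟨ oddBlock-digit t (<-trans z<s 1<b) ⟨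
      oddBlock (0 + t * b)  ≡⟨ cong oddBlock sn≡ ⟨
      oddBlock (suc n)      ≡⟨ odd-sn ⟩
      true                  ∎)
      where open ≡-Reasoning
    split (suc s) s<b sn≡ = inj₁ (begin
      oddBlock n                ≡⟨ cong oddBlock (suc-injective sn≡) ⟩
      oddBlock (s + t * b)      ≡⟨ oddBlock-digit t (<-trans (n<1+n s) s<b) ⟩
      odd t                     ≡⟨ oddBlock-digit t s<b ⟨
      oddBlock (suc s + t * b)  ≡⟨ cong oddBlock sn≡ ⟨
      oddBlock (suc n)          ≡⟨ odd-sn ⟩
      true                      ∎)
      where open ≡-Reasoning

  -- bit r q = oddBlock (q + r * (b + 1)), cf. bit-+b.
  bit : ℕ → ℕ → Bool
  bit zero    q = oddBlock q
  bit (suc r) q = not (bit r (suc q))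

  bit-+b : ∀ r q → bit r (q + b) ≡ not (bit r q)
  bit-+b zero    q = oddBlock-+b q
  bit-+b (suc r) q = cong not (bit-+b r (suc q))

  bit-∸b : ∀ r m {y} → b ≤ y → bit r (m + (y ∸ b)) ≡ not (bit r (m + y))
  bit-∸b r m {y} b≤y = begin
    bit r (m + (y ∸ b))              ≡⟨ not-involutive _ ⟨
    not (not (bit r (m + (y ∸ b))))  ≡⟨ cong not (bit-+b r (m + (y ∸ b))) ⟨
    not (bit r (m + (y ∸ b) + b))    ≡⟨ cong (λ q → not (bit r q)) (trans (+-assoc m (y ∸ b) b) (cong (m +_) (m∸n+n≡m b≤y))) ⟩
    not (bit r (m + y))              ∎
    where open ≡-Reasoning

  -- Columns r > x₁ do not occur.
  column : ℕ → ℕ → ℕ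
  column r q with r <? x₁
  ... | yes _ = toℕ (bit r q)
  ... | no  _ = mex*-pair (bit 0 q) (not (bit x₁ q))

  column-inner : ∀ {r} q → r < x₁ → column r q ≡ toℕ (bit r q)
  column-inner {r} q r<x₁ with r <? x₁
  ... | yes _     = refl
  ... | no  r≮x₁ = contradiction r<x₁ r≮x₁

  column-last : ∀ q → column x₁ q ≡ mex*-pair (bit 0 q) (not (bit x₁ q))
  column-last q with x₁ <? x₁
  ... | yes x₁<x₁ = contradiction x₁<x₁ (n≮n x₁)
  ... | no  _     = refl

  column-bit-or-2 : ∀ {r} q → r ≤ x₁ → column r q ≡ toℕ (bit r q) ⊎ column r q ≡ 2
  column-bit-or-2 {r} q r≤x₁ with m≤n⇒m<n∨m≡n r≤x₁
  ... | inj₁ r<x₁ = inj₁ (column-inner q r<x₁)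
  ... | inj₂ refl with mex*-pair-right (bit 0 q) (not (bit x₁ q))
  ...   | inj₁ ≡toℕ = inj₁ (trans (column-last q) (trans ≡toℕ (cong toℕ (not-involutive (bit x₁ q)))))
  ...   | inj₂ ≡2    = inj₂ (trans (column-last q) ≡2)

  K : ℕ
  K = suc x₁

  sg* : ℕ → ℕ → ℕ
  sg* x y = column (x % K) (x / K + y)

  sg*-column : ∀ {r} m y → r ≤ x₁ → sg* (r + m * K) y ≡ column r (m + y)
  sg*-column {r} m y r≤x₁ =
    cong₂ column (trans ([m+kn]%n≡m%n r m K) (m<n⇒m%n≡m (s≤s r≤x₁))) (cong (_+ y) ([s+t*n]/n≡t m K (s≤s r≤x₁)))

  sg*-diagonal : ∀ x y → sg* (x + x₁ + 1) y ≡ sg* x (suc y)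
  sg*-diagonal x y = begin
    sg* (x + x₁ + 1) y                      ≡⟨ cong (λ x′ → sg* x′ y) (trans (+-assoc x x₁ 1) (cong (x +_) (+-comm x₁ 1))) ⟩
    column ((x + K) % K) ((x + K) / K + y)  ≡⟨ cong₂ column ([m+n]%n≡m%n x K) (cong (_+ y) ([m+n]/n≡1+m/n x K)) ⟩
    column (x % K) (suc (x / K) + y)        ≡⟨ cong (column (x % K)) (+-suc (x / K) y) ⟨
    sg* x (suc y)                           ∎
    where open ≡-Reasoning

  0<x₁ : 0 < x₁
  0<x₁ = >-nonZero⁻¹ x₁

  inner-A : ∀ {r} m {y} → r < x₁ → b ≤ y → sg* (r + m * K) (y ∸ b) ≡ toℕ (not (bit r (m + y)))
  inner-A {r} m r<x₁ b≤y =
    trans (sg*-column m _ (<⇒≤ r<x₁)) (trans (column-inner _ r<x₁) (cong toℕ (bit-∸b r m b≤y)))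

  inner-B : ∀ r m′ y → suc r ≤ x₁ → sg* (r + suc m′ * K ∸ x₁) y ≡ column (suc r) (m′ + y)
  inner-B r m′ y r<x₁ = trans (cong (λ x → sg* x y) position) (sg*-column m′ y r<x₁)
    where
    position : r + suc m′ * K ∸ x₁ ≡ suc r + m′ * K
    position = trans (cong (_∸ x₁) (+-swap-suc r x₁ (m′ * K))) (m+n∸m≡n x₁ (suc r + m′ * K))
      where
      +-swap-suc : ∀ r x t → r + (suc x + t) ≡ x + (suc r + t)
      +-swap-suc r x t = begin
        r + suc (x + t)    ≡⟨ +-suc r (x + t) ⟩
        suc (r + (x + t))  ≡⟨ cong suc (+-assoc r x t) ⟨
        suc (r + x + t)    ≡⟨ cong (λ s → suc (s + t)) (+-comm r x) ⟩
        suc (x + r + t)    ≡⟨ cong suc (+-assoc x r t) ⟩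
        suc (x + (r + t))  ≡⟨ +-suc x (r + t) ⟨
        x + suc (r + t)    ∎
        where open ≡-Reasoning

  C-at-suc : ∀ r′ m y → suc r′ ≤ x₁ → sg* (suc r′ + m * K ∸ 1) (suc y) ≡ toℕ (not (bit (suc r′) (m + y)))
  C-at-suc r′ m y r<x₁ = begin
    sg* (r′ + m * K) (suc y)          ≡⟨ sg*-column m (suc y) (<⇒≤ r<x₁) ⟩
    column r′ (m + suc y)             ≡⟨ column-inner _ r<x₁ ⟩
    toℕ (bit r′ (m + suc y))          ≡⟨ cong (λ q → toℕ (bit r′ q)) (+-suc m y) ⟩
    toℕ (bit r′ (suc (m + y)))        ≡⟨ cong toℕ (not-involutive _) ⟨
    toℕ (not (bit (suc r′) (m + y)))  ∎
    where open ≡-Reasoning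

  C-at-zero : ∀ m′ y → sg* (0 + suc m′ * K ∸ 1) (suc y) ≡ column x₁ (suc m′ + y)
  C-at-zero m′ y = trans (sg*-column m′ (suc y) ≤-refl) (cong (column x₁) (+-suc m′ y))

  last-A : ∀ m {y} → b ≤ y →
    sg* (x₁ + m * K) (y ∸ b) ≡ mex*-pair (not (bit 0 (m + y))) (not (not (bit x₁ (m + y))))
  last-A m b≤y = trans (sg*-column m _ ≤-refl)
    (trans (column-last _) (cong₂ mex*-pair (bit-∸b 0 m b≤y) (cong not (bit-∸b x₁ m b≤y))))

  last-B : ∀ m y → sg* (x₁ + m * K ∸ x₁) y ≡ toℕ (bit 0 (m + y))
  last-B m y = trans (cong (λ x → sg* x y) (m+n∸m≡n x₁ (m * K))) (trans (sg*-column m y z≤n) (column-inner _ 0<x₁))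

  last-C : ∀ m y → sg* (x₁ + m * K ∸ 1) (suc y) ≡ toℕ (not (bit x₁ (m + y)))
  last-C m y = subst (λ x₁′ → sg* (x₁′ + m * K ∸ 1) (suc y) ≡ toℕ (not (bit x₁′ (m + y))))
    (suc-pred x₁) (C-at-suc (pred x₁) m y (≤-reflexive (suc-pred x₁)))

  sg*-options : ℕ → ℕ → List ℕ
  sg*-options = options b x₁ sg*

  inner-B-bit-or-2 : ∀ r m y → r < x₁ → x₁ ≤ r + m * K →
    sg* (r + m * K ∸ x₁) y ≡ toℕ (not (bit r (m + y))) ⊎ sg* (r + m * K ∸ x₁) y ≡ 2
  inner-B-bit-or-2 r zero y r<x₁ x₁≤r = contradiction (subst (x₁ ≤_) (+-identityʳ r) x₁≤r) (<⇒≱ r<x₁)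
  inner-B-bit-or-2 r (suc m′) y r<x₁ _ rewrite inner-B r m′ y r<x₁ = column-bit-or-2 (m′ + y) r<x₁

  inner-C-bit-or-2 : ∀ r m y → r < x₁ → 1 ≤ r + m * K →
    sg* (r + m * K ∸ 1) (suc y) ≡ toℕ (not (bit r (m + y))) ⊎ sg* (r + m * K ∸ 1) (suc y) ≡ 2
  inner-C-bit-or-2 (suc r′) m        y r<x₁ _ = inj₁ (C-at-suc r′ m y (<⇒≤ r<x₁))
  inner-C-bit-or-2 zero     (suc m′) y _    _ rewrite C-at-zero m′ y | column-last (suc m′ + y) =
    mex*-pair-left (bit 0 (suc m′ + y)) (not (bit x₁ (suc m′ + y)))

  inner-options : ∀ r m y → r < x₁ →
    All (λ v → v ≡ toℕ (not (bit r (m + y))) ⊎ v ≡ 2) (sg*-options (r + m * K) y)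
  inner-options r m y r<x₁ = All-options b x₁ sg* (r + m * K) y
    (λ b≤y → inj₁ (inner-A m r<x₁ b≤y)) (inner-B-bit-or-2 r m y r<x₁) (inner-C-bit-or-2 r m y r<x₁)

  column-last-x₁≡1 : x₁ ≡ 1 → ∀ q → column x₁ q ≡ mex*-pair (oddBlock q) (oddBlock (suc q))
  column-last-x₁≡1 x₁≡1 q = trans (column-last q)
    (cong (mex*-pair (oddBlock q)) (trans (cong (λ r → not (bit r q)) x₁≡1) (not-involutive _)))

  B∈ : ∀ m′ {y} → sg* (suc m′ * K ∸ x₁) y ∈ sg*-options (suc m′ * K) y
  B∈ m′ {y} = ∈-options-B b x₁ sg* _ y (m≤n⇒m≤1+n (m≤m+n x₁ (m′ * K)))

  column-0-zero-option : (x₁ ≡ 1 → 1 < b) → ∀ m′ y → oddBlock (suc m′ + y) ≡ true →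
    0 ∈ sg*-options (suc m′ * K) y
  column-0-zero-option x₁≡1⇒1<b m′ y β with x₁ ≟ 1
  ... | no x₁≢1 = subst (_∈ sg*-options (suc m′ * K) y) B-value (B∈ m′)
    where
    1<x₁ : 1 < x₁
    1<x₁ = ≤∧≢⇒< 0<x₁ (x₁≢1 ∘ sym)
    B-value : sg* (suc m′ * K ∸ x₁) y ≡ 0
    B-value = trans (inner-B 0 m′ y 0<x₁) (trans (column-inner _ 1<x₁) (cong (toℕ ∘ not) β))
  ... | yes x₁≡1 with oddBlock-neighbour (x₁≡1⇒1<b x₁≡1) (m′ + y) β
  ...   | inj₁ odd-prev = subst (_∈ sg*-options (suc m′ * K) y) B-value (B∈ m′)
    where
    B-value : sg* (suc m′ * K ∸ x₁) y ≡ 0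
    B-value = begin
      sg* (suc m′ * K ∸ x₁) y                                 ≡⟨ inner-B 0 m′ y 0<x₁ ⟩
      column 1 (m′ + y)                                       ≡⟨ cong (λ r → column r (m′ + y)) x₁≡1 ⟨
      column x₁ (m′ + y)                                      ≡⟨ column-last-x₁≡1 x₁≡1 (m′ + y) ⟩
      mex*-pair (oddBlock (m′ + y)) (oddBlock (suc m′ + y))   ≡⟨ cong₂ mex*-pair odd-prev β ⟩
      0                                                       ∎
      where open ≡-Reasoning
  ...   | inj₂ odd-next = subst (_∈ sg*-options (suc m′ * K) y) C-value C∈
    where
    C-value : sg* (suc m′ * K ∸ 1) (suc y) ≡ 0
    C-value = begin
      sg* (suc m′ * K ∸ 1) (suc y)                               ≡⟨ C-at-zero m′ y ⟩
      column x₁ (suc m′ + y)                                     ≡⟨ column-last-x₁≡1 x₁≡1 (suc m′ + y) ⟩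
      mex*-pair (oddBlock (suc m′ + y)) (oddBlock (2 + m′ + y))  ≡⟨ cong₂ mex*-pair β odd-next ⟩
      0                                                          ∎
      where open ≡-Reasoning
    C∈ : sg* (suc m′ * K ∸ 1) (suc y) ∈ sg*-options (suc m′ * K) y
    C∈ = ∈-options-C b x₁ sg* _ y (s≤s z≤n)

  inner-zero-option : (x₁ ≡ 1 → 1 < b) → ∀ r m y → r < x₁ → bit r (m + y) ≡ true →
    0 ∈ sg*-options (r + m * K) y
  inner-zero-option _ (suc r′) m y r<x₁ β =
    subst (_∈ sg*-options (suc r′ + m * K) y) (trans (C-at-suc r′ m y (<⇒≤ r<x₁)) (cong (toℕ ∘ not) β))
      (∈-options-C b x₁ sg* _ y (s≤s z≤n))
  inner-zero-option x₁≡1⇒1<b zero m y 0<x₁ β with y <? b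
  ... | no y≮b = subst (_∈ sg*-options (m * K) y) (trans (inner-A m 0<x₁ b≤y) (cong (toℕ ∘ not) β))
                   (∈-options-A b x₁ sg* _ y b≤y)
    where
    b≤y : b ≤ y
    b≤y = ≮⇒≥ y≮b
  ... | yes y<b with m
  ...   | zero   = contradiction (trans (sym β) (oddBlock-< y<b)) λ ()
  ...   | suc m′ = column-0-zero-option x₁≡1⇒1<b m′ y β

  inner-column : (x₁ ≡ 1 → 1 < b) → ∀ {r} m y → r < x₁ → mex* (sg*-options (r + m * K) y) ≡ column r (m + y)
  inner-column x₁≡1⇒1<b {r} m y r<x₁ =
    trans (mex*-bit (bit r (m + y)) (inner-options r m y r<x₁) (inner-zero-option x₁≡1⇒1<b r m y r<x₁))
          (sym (column-inner (m + y) r<x₁))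

  last-column : ∀ m y → mex* (sg*-options (x₁ + m * K) y) ≡ column x₁ (m + y)
  last-column m y = trans (mex*≡mex*-pair c d values c∈ d∈) (sym (column-last (m + y)))
    where
    c d : Bool
    c = bit 0 (m + y)
    d = not (bit x₁ (m + y))
    x₁≤x : x₁ ≤ x₁ + m * K
    x₁≤x = m≤m+n x₁ (m * K)
    values : All (λ v → v ≡ toℕ c ⊎ v ≡ toℕ d ⊎ v ≡ mex*-pair (not c) (not d)) (sg*-options (x₁ + m * K) y)
    values = All-options b x₁ sg* _ y (λ b≤y → inj₂ (inj₂ (last-A m b≤y))) (λ _ → inj₁ (last-B m y))
      (λ _ → inj₂ (inj₁ (last-C m y)))
    c∈ : toℕ c ∈ sg*-options (x₁ + m * K) y
    c∈ = subst (_∈ sg*-options (x₁ + m * K) y) (last-B m y) (∈-options-B b x₁ sg* _ y x₁≤x)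
    d∈ : toℕ d ∈ sg*-options (x₁ + m * K) y
    d∈ = subst (_∈ sg*-options (x₁ + m * K) y) (last-C m y) (∈-options-C b x₁ sg* _ y (≤-trans 0<x₁ x₁≤x))

  sg*-solves : (x₁ ≡ 1 → 1 < b) → ∀ x y → mex* (sg*-options x y) ≡ sg* x y
  sg*-solves x₁≡1⇒1<b x y = begin
    mex* (sg*-options x y)            ≡⟨ cong (λ x → mex* (sg*-options x y)) x≡r+mK ⟩
    mex* (sg*-options (r + m * K) y)  ≡⟨ by-column (m≤n⇒m<n∨m≡n r≤x₁) ⟩
    column r (m + y)                  ≡⟨ sg*-column m y r≤x₁ ⟨
    sg* (r + m * K) y                 ≡⟨ cong (λ x → sg* x y) x≡r+mK ⟨
    sg* x y                           ∎
    where
    open ≡-Reasoning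
    r m : ℕ
    r = x % K
    m = x / K
    r≤x₁ : r ≤ x₁
    r≤x₁ = s≤s⁻¹ (m%n<n x K)
    x≡r+mK : x ≡ r + m * K
    x≡r+mK = m≡m%n+[m/n]*n x K
    by-column : r < x₁ ⊎ r ≡ x₁ → mex* (sg*-options (r + m * K) y) ≡ column r (m + y)
    by-column (inj₁ r<x₁) = inner-column x₁≡1⇒1<b m y r<x₁
    by-column (inj₂ r≡x₁) =
      subst (λ r → mex* (sg*-options (r + m * K) y) ≡ column r (m + y)) (sym r≡x₁) (last-column m y)

mainTheorem7 : (b x₁ : ℕ) → 0 < b → 0 < x₁ → ¬ (b ≡ 1 × x₁ ≡ 1) →
    DiagonalPeriodic b x₁ 0 1 1
mainTheorem7 (suc b′) (suc x₁′) _ _ ¬b≡1×x₁≡1 x y 1≤y = begin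
  SG* (G x y)                        ≡⟨ SG*≡sg* x y ⟩
  sg* x y                            ≡⟨ cong (sg* x) (m+[n∸m]≡n 1≤y) ⟨
  sg* x (suc (y ∸ 1))                ≡⟨ sg*-diagonal x (y ∸ 1) ⟨
  sg* (x + suc x₁′ + 1) (y ∸ 1)      ≡⟨ SG*≡sg* (x + suc x₁′ + 1) (y ∸ 1) ⟨
  SG* (G (x + suc x₁′ + 1) (y ∸ 1))  ∎
  where
  open ≡-Reasoning
  open Unfolding b′ x₁′ using (G; SG*-unique)
  open ClosedForm (suc b′) (suc x₁′)
  x₁≡1⇒1<b : suc x₁′ ≡ 1 → 1 < suc b′
  x₁≡1⇒1<b x₁≡1 = ≤∧≢⇒< (s≤s z≤n) (λ 1≡b → ¬b≡1×x₁≡1 (sym 1≡b , x₁≡1))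
  SG*≡sg* : ∀ x y → SG* (G x y) ≡ sg* x y
  SG*≡sg* = SG*-unique sg* (sg*-solves x₁≡1⇒1<b)
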